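{- Let $D=\{d_1,\ldots,d_n\}$ be an instance of 2-Visits with $d_1\leq\cdots\leq d_n$ and $d_i\leq 2n$ for all $i$, let $A=\langle a_1,\ldots,a_n\rangle$ be its discretized sequence, and let $T=[2n]\setminus\{a_1,\ldots,a_n\}$. If $\mathrm{Dens}(D)\leq\sqrt{2}-1/2$, then $|T\cap[d_i+a_i]|\geq i$ for all $i\in[n]$.
   Context: 2-Visits: given a multiset of positive integers (deadlines) $D=\{d_1,\ldots,d_n\}$, decide whether there is a sequence of length $2n$ containing each $i\in[n]$ exactly twice, with the first occurrence of $i$ within the first $d_i$ positions and the second at most $d_i$ positions after the first. Discretized sequence: $a_n=d_n$ and $a_i=\min\{a_{i+1}-1,\ d_i\}$ for $i<n$. $[m]=\{1,\ldots,m\}$. The density of $D$ is $\mathrm{Dens}(D)=\sum_{i=1}^n 1/d_i$. -}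

module Defs where

open import Data.Nat as ℕ using (ℕ; zero; suc)
open import Data.Integer as ℤ using (ℤ; +_)
open import Data.Rational as ℚ using (ℚ)
open import Data.Vec using (Vec; []; _∷_; foldr)
open import Data.Bool using (Bool; true; false; _∨_; _∧_; not)
open import Relation.Nullary.Decidable using (does)

-- Indices i ∈ [n] are represented 0-based as Fin n (i ↦ toℕ i + 1).

-- Discretized sequence, computed from the last entry backwards:
--   a_n = d_n,  a_i = min (a_{i+1} - 1) d_i.
-- Values are integers (a_i could a priori be ≤ 0).
discStep : ∀ {n} → ℕ → Vec ℤ n → Vec ℤ (suc n)
discStep d []       = (+ d) ∷ []
discStep d (a ∷ as) = ℤ._⊓_ (a ℤ.- (+ 1)) (+ d) ∷ a ∷ as

discretized : ∀ {n} → Vec ℕ n → Vec ℤ n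
discretized []       = []
discretized (d ∷ ds) = discStep d (discretized ds)

-- 1/d as a rational (d = 0 never occurs under the positivity hypothesis).
recip : ℕ → ℚ
recip zero    = ℚ.0ℚ
recip (suc k) = (+ 1) ℚ./ (suc k)

Dens : ∀ {n} → Vec ℕ n → ℚ
Dens = foldr _ (λ d s → recip d ℚ.+ s) ℚ.0ℚ

memℤ : ∀ {n} → ℤ → Vec ℤ n → Bool
memℤ x []       = false
memℤ x (a ∷ as) = does (x ℤ.≟ a) ∨ memℤ x as

-- countT N as b = |{ t ∈ [N] : t ∉ as, t ≤ b }|
-- so that |T ∩ [b]| with T = [2n] \ {a_1..a_n} is countT (2n) A b.
countT : ∀ {n} → ℕ → Vec ℤ n → ℤ → ℕ
countT zero    as b = 0
countT (suc t) as b with does ((+ suc t) ℤ.≤? b) ∧ not (memℤ (+ suc t) as)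
... | true  = suc (countT t as b)
... | false = countT t as b

module Submission where

-- Indices are 0-based, so the claim for index i reads i + 1 ≤ |T ∩ [d_i + a_i]|.
-- Since Dens(D) ≤ √2 − ½ < 1, no sorted prefix d_0 … d_j has d_j ≤ j; hence
-- a_j = min_{l ≥ j} (d_l − l + j) equals j + 1 + m_j for some m_j ≥ 0. Fix i, write x = d_i,
-- a_i = i + 1 + m (attained at p ≥ i, so d_p = p + 1 + m) and K = x + m. Every l ≥ K has
-- d_l ≥ l + i + 2: otherwise m ≤ i, and bounding each 1/d_j from below by the reciprocal of
-- the last deadline of its block, for the blocks [0, i], (i, p] and (p, l] (only the first two
-- when p ≥ K), gives Dens(D) ≥ (m + 1)/x + x/(x + 2m + 1) > √2 − ½ by AM–GM.
-- So a_j > d_i + a_i = i + 1 + K for all j ≥ K: at most K of the a_j lie in [d_i + a_i], which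
-- leaves at least i + 1 elements of T there (at least n > i of them if d_i + a_i ≥ 2n).

open import Data.Nat as ℕ using (ℕ; zero; suc; _≤_; _<_; _*_; z≤n; s≤s; _≤?_)
import Data.Nat.Properties as ℕ
open import Data.Nat.Tactic.RingSolver using (solve-∀)
open import Data.Integer as ℤ using (ℤ; +_)
import Data.Integer.Properties as ℤ
import Data.Integer.Tactic.RingSolver as ℤ-Solver
open import Data.Rational as ℚ using (ℚ; _/_; 0ℚ; 1ℚ; ½)
import Data.Rational.Properties as ℚ
open import Data.Rational.Unnormalised as ℚᵘ using (mkℚᵘ; *≤*; *<*)
import Data.Rational.Unnormalised.Properties as ℚᵘ
open import Data.Bool using (true; false; _∧_; not)
open import Data.Fin as Fin using (Fin; toℕ; fromℕ<)
import Data.Fin.Properties as Fin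
open import Data.Vec using (Vec; []; _∷_; lookup; count)
open import Data.Vec.Properties using (count≤n)
open import Data.Product using (_×_; _,_; ∃-syntax)
open import Data.Sum using ([_,_]′)
open import Data.Empty using (⊥)
open import Function using (_∘_)
open import Relation.Nullary using (¬_; yes; no; contradiction)
open import Relation.Nullary.Decidable using (does; from-no)
open import Relation.Binary.PropositionalEquality
open import Algebra.Bundles using (AbelianGroup; CommutativeMonoid)
open import Defs

module Fractions where

  open import Data.Nat using (_+_)

  private
    toℚᵘ-/suc : ∀ a b → ℚ.toℚᵘ (+ a / suc b) ℚᵘ.≃ mkℚᵘ (+ a) b
    toℚᵘ-/suc a b = ℚ.toℚᵘ-fromℚᵘ (mkℚᵘ (+ a) b)

    +-homo-* : ∀ m n → + m ℤ.* + n ≡ + (m * n)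
    +-homo-* m n = ℤ.+◃n≡+n (m * n)

    toℚᵘ≃⇒≡/suc : ∀ {p} a b → ℚ.toℚᵘ p ℚᵘ.≃ mkℚᵘ (+ a) b → p ≡ + a / suc b
    toℚᵘ≃⇒≡/suc a b p≃ = ℚ.toℚᵘ-injective (ℚᵘ.≃-trans p≃ (ℚᵘ.≃-sym (toℚᵘ-/suc a b)))

  *≤*⇒/≤/ : ∀ a b c e → a * suc e ≤ c * suc b → + a / suc b ℚ.≤ + c / suc e
  *≤*⇒/≤/ a b c e h = ℚ.toℚᵘ-cancel-≤
    (ℚᵘ.≤-respˡ-≃ (ℚᵘ.≃-sym (toℚᵘ-/suc a b)) (ℚᵘ.≤-respʳ-≃ (ℚᵘ.≃-sym (toℚᵘ-/suc c e))
      (*≤* (subst₂ ℤ._≤_ (sym (+-homo-* a (suc e))) (sym (+-homo-* c (suc b))) (ℤ.+≤+ h)))))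

  *<*⇒/</ : ∀ a b c e → a * suc e < c * suc b → + a / suc b ℚ.< + c / suc e
  *<*⇒/</ a b c e h = ℚ.toℚᵘ-cancel-<
    (ℚᵘ.<-respˡ-≃ (ℚᵘ.≃-sym (toℚᵘ-/suc a b)) (ℚᵘ.<-respʳ-≃ (ℚᵘ.≃-sym (toℚᵘ-/suc c e))
      (*<* (subst₂ ℤ._<_ (sym (+-homo-* a (suc e))) (sym (+-homo-* c (suc b))) (ℤ.+<+ h)))))

  /+/≡ : ∀ a b c e → + a / suc b ℚ.+ + c / suc e ≡ + (a * suc e + c * suc b) / (suc b * suc e)
  /+/≡ a b c e = toℚᵘ≃⇒≡/suc (a * suc e + c * suc b) (e + b * suc e)
    (ℚᵘ.≃-trans (ℚ.toℚᵘ-homo-+ (+ a / suc b) (+ c / suc e))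
      (ℚᵘ.≃-trans (ℚᵘ.+-cong (toℚᵘ-/suc a b) (toℚᵘ-/suc c e))
        (ℚᵘ.≃-reflexive (cong₂ (λ u v → mkℚᵘ (u ℤ.+ v) _) (+-homo-* a (suc e)) (+-homo-* c (suc b))))))

  /*/≡ : ∀ a b c e → (+ a / suc b) ℚ.* (+ c / suc e) ≡ + (a * c) / (suc b * suc e)
  /*/≡ a b c e = toℚᵘ≃⇒≡/suc (a * c) (e + b * suc e)
    (ℚᵘ.≃-trans (ℚ.toℚᵘ-homo-* (+ a / suc b) (+ c / suc e))
      (ℚᵘ.≃-trans (ℚᵘ.*-cong (toℚᵘ-/suc a b) (toℚᵘ-/suc c e))
        (ℚᵘ.≃-reflexive (cong (λ u → mkℚᵘ u _) (+-homo-* a c)))))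

  *≡*⇒/≡/ : ∀ a b c e → a * suc e ≡ c * suc b → + a / suc b ≡ + c / suc e
  *≡*⇒/≡/ a b c e eq =
    ℚ.≤-antisym (*≤*⇒/≤/ a b c e (ℕ.≤-reflexive eq)) (*≤*⇒/≤/ c e a b (ℕ.≤-reflexive (sym eq)))

  /-distribʳ-+ : ∀ a c b → + (a + c) / suc b ≡ + a / suc b ℚ.+ + c / suc b
  /-distribʳ-+ a c b = sym (trans (/+/≡ a b c b) (*≡*⇒/≡/ (a * suc b + c * suc b) (b + b * suc b) (a + c) b (lemma a c b)))
    where
    lemma : ∀ a c b → (a * suc b + c * suc b) * suc b ≡ (a + c) * (suc b * suc b)
    lemma = solve-∀

  0/suc≡0 : ∀ b → + 0 / suc b ≡ 0ℚ
  0/suc≡0 b = *≡*⇒/≡/ 0 b 0 0 refl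

  0≤/suc : ∀ a b → 0ℚ ℚ.≤ + a / suc b
  0≤/suc a b = *≤*⇒/≤/ 0 0 a b z≤n

  /-antitoneʳ : ∀ a {b e} → b ≤ e → + a / suc e ℚ.≤ + a / suc b
  /-antitoneʳ a {b} {e} b≤e = *≤*⇒/≤/ a e a b (ℕ.*-monoʳ-≤ a (s≤s b≤e))

  /-≤-+both : ∀ a b g → a ≤ suc b → + a / suc b ℚ.≤ + (a + g) / suc (b + g)
  /-≤-+both a b g a≤1+b = *≤*⇒/≤/ a b (a + g) (b + g) (begin
    a * suc (b + g)       ≡⟨ expandˡ a b g ⟩
    a * suc b + a * g     ≤⟨ ℕ.+-monoʳ-≤ (a * suc b) (ℕ.*-monoˡ-≤ g a≤1+b) ⟩
    a * suc b + suc b * g ≡⟨ expandʳ a b g ⟩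
    (a + g) * suc b       ∎)
    where
    open ℕ.≤-Reasoning
    expandˡ : ∀ a b g → a * suc (b + g) ≡ a * suc b + a * g
    expandˡ = solve-∀
    expandʳ : ∀ a b g → a * suc b + suc b * g ≡ (a + g) * suc b
    expandʳ = solve-∀

  /-≤-split : ∀ x h k c → c ≤ h →
    + (k + c) / suc (x + h) ℚ.≤ + k / suc x ℚ.+ + c / suc (x + h + k)
  /-≤-split x h k c c≤h = subst (+ (k + c) / suc (x + h) ℚ.≤_) (sym (/+/≡ k x c (x + h + k)))
    (*≤*⇒/≤/ (k + c) (x + h) (k * E + c * X) (x + h + k + x * E) (begin
      (k + c) * (X * E)               ≡⟨ lhs x h k c ⟩
      k * (X * E + c * X) + c * X * D ≤⟨ ℕ.+-monoˡ-≤ (c * X * D) (ℕ.*-monoʳ-≤ k XE+cX≤DE) ⟩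
      k * (D * E) + c * X * D         ≡⟨ rhs x h k c ⟩
      (k * E + c * X) * D             ∎))
    where
    open ℕ.≤-Reasoning
    X = suc x
    D = suc (x + h)
    E = suc (x + h + k)
    X≤E : X ≤ E
    X≤E = s≤s (ℕ.≤-trans (ℕ.m≤m+n x h) (ℕ.m≤m+n (x + h) k))
    XE+cX≤DE : X * E + c * X ≤ D * E
    XE+cX≤DE = begin
      X * E + c * X ≤⟨ ℕ.+-monoʳ-≤ (X * E) (ℕ.*-mono-≤ c≤h X≤E) ⟩
      X * E + h * E ≡⟨ ℕ.*-distribʳ-+ E X h ⟨
      D * E         ∎
    lhs : ∀ x h k c → let X = suc x; D = suc (x + h); E = suc (x + h + k) in
          (k + c) * (X * E) ≡ k * (X * E + c * X) + c * X * D
    lhs = solve-∀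
    rhs : ∀ x h k c → let X = suc x; D = suc (x + h); E = suc (x + h + k) in
          k * (D * E) + c * X * D ≡ (k * E + c * X) * D
    rhs = solve-∀

module DensityThreshold where

  open import Data.Nat using (_+_)
  open import Algebra.Properties.CommutativeSemigroup (CommutativeMonoid.commutativeSemigroup ℚ.+-0-commutativeMonoid)
    using (xy∙z≈x∙zy)
  open Fractions

  4mn≤[m+n]² : ∀ m n → 4 * m * n ≤ (m + n) * (m + n)
  4mn≤[m+n]² m n =
    [ ordered , subst₂ _≤_ (swap n m) (cong (λ k → k * k) (ℕ.+-comm n m)) ∘ ordered ]′ (ℕ.≤-total m n)
    where
    swap : ∀ n m → 4 * n * m ≡ 4 * m * n
    swap = solve-∀
    square : ∀ m s → 4 * m * (m + s) + s * s ≡ (m + (m + s)) * (m + (m + s))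
    square = solve-∀
    ordered : ∀ {m n} → m ≤ n → 4 * m * n ≤ (m + n) * (m + n)
    ordered {m} m≤n with s , refl ← ℕ.m≤n⇒∃[o]m+o≡n m≤n =
      subst (4 * m * (m + s) ≤_) (square m s) (ℕ.m≤m+n _ (s * s))

  infix 4 _≤√2-½

  _≤√2-½ : ℚ → Set
  δ ≤√2-½ = (δ ℚ.+ ½) ℚ.* (δ ℚ.+ ½) ℚ.≤ 1ℚ ℚ.+ 1ℚ

  ≤√2-½-antitone : ∀ {t δ} → 0ℚ ℚ.≤ t → t ℚ.≤ δ → δ ≤√2-½ → t ≤√2-½
  ≤√2-½-antitone {t} {δ} 0≤t t≤δ = ℚ.≤-trans (ℚ.≤-trans
    (ℚ.*-monoˡ-≤-nonNeg (t ℚ.+ ½) {{ℚ.nonNegative 0≤t+½}} t+½≤δ+½)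
    (ℚ.*-monoʳ-≤-nonNeg (δ ℚ.+ ½) {{ℚ.nonNegative (ℚ.≤-trans 0≤t+½ t+½≤δ+½)}} t+½≤δ+½))
    where
    t+½≤δ+½ : t ℚ.+ ½ ℚ.≤ δ ℚ.+ ½
    t+½≤δ+½ = ℚ.+-monoˡ-≤ ½ t≤δ
    0≤t+½ : 0ℚ ℚ.≤ t ℚ.+ ½
    0≤t+½ = ℚ.+-mono-≤ 0≤t (0≤/suc 1 1)

  1≰√2-½ : ¬ 1ℚ ≤√2-½
  1≰√2-½ = from-no ((1ℚ ℚ.+ ½) ℚ.* (1ℚ ℚ.+ ½) ℚ.≤? 1ℚ ℚ.+ 1ℚ)

  -- In these names x stands for the deadline 1 + x. With X = 1 + x and D = X + 2m + 1 one has
  -- t + ½ = (D(D + 1) + 2X²)/(2XD), so AM–GM gives (t + ½)² ≥ 8X²D(D + 1)/(2XD)² > 2.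
  [1+m]/x+x/[x+2m+1]≰√2-½ : ∀ x m → ¬ (+ suc m / suc x ℚ.+ + suc x / suc (x + suc (m + m))) ≤√2-½
  [1+m]/x+x/[x+2m+1]≰√2-½ x m t≤√2-½ = ℚ.<-irrefl refl 2<2
    where
    X = suc x
    D = suc (x + suc (m + m))
    t = + suc m / X ℚ.+ + X / D
    2XD = X * D * 2
    2XD-1 = ℕ.pred 2XD
    P = D * suc D
    Q = 2 * (X * X)
    numerator : ∀ x m → let X = suc x; D = suc (x + suc (m + m)) in
      (suc m * D + X * X) * 2 + 1 * (X * D) ≡ D * suc D + 2 * (X * X)
    numerator = solve-∀
    t+½≡ : t ℚ.+ ½ ≡ + (P + Q) / 2XD
    t+½≡ = begin
      t ℚ.+ ½                                         ≡⟨ cong (ℚ._+ ½) (/+/≡ (suc m) x X (x + suc (m + m))) ⟩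
      + (suc m * D + X * X) / (X * D) ℚ.+ + 1 / 2     ≡⟨ /+/≡ (suc m * D + X * X) (ℕ.pred (X * D)) 1 1 ⟩
      + ((suc m * D + X * X) * 2 + 1 * (X * D)) / 2XD ≡⟨ cong (λ n → + n / 2XD) (numerator x m) ⟩
      + (P + Q) / 2XD                                 ∎
      where open ≡-Reasoning
    gap : ∀ x m → let X = suc x; D = suc (x + suc (m + m)) in
      2 * (X * D * 2 * (X * D * 2)) + 8 * (X * X) * D
        ≡ 4 * (D * suc D) * (2 * (X * X))
    gap = solve-∀
    8X²D²<[P+Q]² : 2 * (2XD * 2XD) < (P + Q) * (P + Q) * 1
    8X²D²<[P+Q]² = begin-strict
      2 * (2XD * 2XD)                   <⟨ ℕ.m<m+n _ (s≤s z≤n) ⟩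
      2 * (2XD * 2XD) + 8 * (X * X) * D ≡⟨ gap x m ⟩
      4 * P * Q                         ≤⟨ 4mn≤[m+n]² P Q ⟩
      (P + Q) * (P + Q)                 ≡⟨ ℕ.*-identityʳ _ ⟨
      (P + Q) * (P + Q) * 1             ∎
      where open ℕ.≤-Reasoning
    2<2 : 1ℚ ℚ.+ 1ℚ ℚ.< 1ℚ ℚ.+ 1ℚ
    2<2 = begin-strict
      1ℚ ℚ.+ 1ℚ                               <⟨ *<*⇒/</ 2 0 ((P + Q) * (P + Q)) (2XD-1 + 2XD-1 * 2XD) 8X²D²<[P+Q]² ⟩
      + ((P + Q) * (P + Q)) / (2XD * 2XD)     ≡⟨ /*/≡ (P + Q) 2XD-1 (P + Q) 2XD-1 ⟨
      (+ (P + Q) / 2XD) ℚ.* (+ (P + Q) / 2XD) ≡⟨ cong₂ ℚ._*_ t+½≡ t+½≡ ⟨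
      (t ℚ.+ ½) ℚ.* (t ℚ.+ ½)                 ≤⟨ t≤√2-½ ⟩
      1ℚ ℚ.+ 1ℚ                               ∎
      where open ℚ.≤-Reasoning

  x/[x+2m+1]≤twoBlocks : ∀ x m k q → k ≤ suc x → suc x ≤ k + q →
    + suc x / suc (x + suc (m + m)) ℚ.≤ + k / suc x ℚ.+ + q / suc (m + k + q + m)
  x/[x+2m+1]≤twoBlocks x m k q k≤1+x 1+x≤k+q
    with c , k+c≡1+x ← ℕ.m≤n⇒∃[o]m+o≡n k≤1+x
    with g , refl ← ℕ.m≤n⇒∃[o]m+o≡n (ℕ.+-cancelˡ-≤ k c q (subst (_≤ k + q) (sym k+c≡1+x) 1+x≤k+q))
    = begin
    + suc x / suc h                                       ≡⟨ cong (λ n → + n / suc h) k+c≡1+x ⟨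
    + (k + c) / suc h                                     ≡⟨ /-distribʳ-+ k c h ⟩
    + k / suc h ℚ.+ + c / suc h
        ≤⟨ ℚ.+-mono-≤ (/-antitoneʳ k (ℕ.m≤m+n x _)) (/-≤-+both c h g c≤1+h) ⟩
    + k / suc x ℚ.+ + (c + g) / suc (h + g)               ≡⟨ cong (λ n → + k / suc x ℚ.+ + (c + g) / suc n) h+g≡ ⟩
    + k / suc x ℚ.+ + (c + g) / suc (m + k + (c + g) + m) ∎
    where
    open ℚ.≤-Reasoning
    h = x + suc (m + m)
    c≤1+h : c ≤ suc h
    c≤1+h = ℕ.≤-trans (ℕ.m≤n+m c k) (subst (_≤ suc h) (sym k+c≡1+x) (s≤s (ℕ.m≤m+n x _)))
    h+g≡ : h + g ≡ m + k + (c + g) + m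
    h+g≡ = trans (shift x m g) (trans (cong (λ n → n + (m + m + g)) (sym k+c≡1+x)) (regroup k c m g))
      where
      shift : ∀ x m g → x + suc (m + m) + g ≡ suc x + (m + m + g)
      shift = solve-∀
      regroup : ∀ k c m g → k + c + (m + m + g) ≡ m + k + (c + g) + m
      regroup = solve-∀

  x/[x+2m+1]≤threeBlocks : ∀ x m k q c g → m + k + q + c ≡ suc x + m → c ≤ suc (m + m) →
    + suc x / suc (x + suc (m + m)) ℚ.≤
      + k / suc x ℚ.+ (+ q / suc (m + k + q + m) ℚ.+ + (c + g) / suc (m + k + q + (c + g) + (m + k)))
  x/[x+2m+1]≤threeBlocks x m k q c g p+c≡1+x+m c≤1+2m = begin
    + suc x / suc h                   ≡⟨ cong (λ n → + n / suc h) k+c+q≡1+x ⟨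
    + (k + c + q) / suc h             ≡⟨ /-distribʳ-+ (k + c) q h ⟩
    + (k + c) / suc h ℚ.+ + q / suc h ≤⟨ ℚ.+-mono-≤ (/-≤-split x (suc (m + m)) k c c≤1+2m) (/-antitoneʳ q p+m≤h) ⟩
    (+ k / suc x ℚ.+ + c / suc (h + k)) ℚ.+ + q / suc p+m
        ≤⟨ ℚ.+-monoˡ-≤ (+ q / suc p+m) (ℚ.+-monoʳ-≤ (+ k / suc x) (/-≤-+both c (h + k) g c≤1+h+k)) ⟩
    (+ k / suc x ℚ.+ + (c + g) / suc (h + k + g)) ℚ.+ + q / suc p+m ≡⟨ xy∙z≈x∙zy (+ k / suc x) _ _ ⟩
    + k / suc x ℚ.+ (+ q / suc p+m ℚ.+ + (c + g) / suc (h + k + g))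
        ≡⟨ cong (λ n → + k / suc x ℚ.+ (+ q / suc p+m ℚ.+ + (c + g) / suc n)) h+k+g≡ ⟩
    + k / suc x ℚ.+ (+ q / suc p+m ℚ.+ + (c + g) / suc (m + k + q + (c + g) + (m + k))) ∎
    where
    open ℚ.≤-Reasoning
    h = x + suc (m + m)
    p+m = m + k + q + m
    1+x+m+m≡h : ∀ x m → suc x + m + m ≡ x + suc (m + m)
    1+x+m+m≡h = solve-∀
    k+c+q≡1+x : k + c + q ≡ suc x
    k+c+q≡1+x = ℕ.+-cancelʳ-≡ m (k + c + q) (suc x) (trans (regroup m k q c) p+c≡1+x+m)
      where
      regroup : ∀ m k q c → k + c + q + m ≡ m + k + q + c
      regroup = solve-∀
    p+m≤h : p+m ≤ h
    p+m≤h = ℕ.≤-trans (ℕ.+-monoˡ-≤ m (ℕ.≤-trans (ℕ.m≤m+n _ c) (ℕ.≤-reflexive p+c≡1+x+m)))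
                      (ℕ.≤-reflexive (1+x+m+m≡h x m))
    c≤1+h+k : c ≤ suc (h + k)
    c≤1+h+k = ℕ.≤-trans c≤1+2m (ℕ.≤-trans (ℕ.m≤n+m _ x) (ℕ.≤-trans (ℕ.m≤m+n h k) (ℕ.n≤1+n _)))
    h+k+g≡ : h + k + g ≡ m + k + q + (c + g) + (m + k)
    h+k+g≡ = trans (cong (λ n → n + k + g) (sym (1+x+m+m≡h x m)))
      (trans (cong (λ n → n + m + k + g) (sym p+c≡1+x+m)) (regroup m k q c g))
      where
      regroup : ∀ m k q c g → m + k + q + c + m + k + g ≡ m + k + q + (c + g) + (m + k)
      regroup = solve-∀

  [1+m+k]/x+r≰√2-½ : ∀ x m k r {δ} → + suc x / suc (x + suc (m + m)) ℚ.≤ + k / suc x ℚ.+ r →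
                     + suc (m + k) / suc x ℚ.+ r ℚ.≤ δ → ¬ δ ≤√2-½
  [1+m+k]/x+r≰√2-½ x m k r {δ} x/D≤k/x+r 1+m+k/x+r≤δ =
    [1+m]/x+x/[x+2m+1]≰√2-½ x m ∘ ≤√2-½-antitone (ℚ.+-mono-≤ (0≤/suc (suc m) x) (0≤/suc (suc x) _)) t≤δ
    where
    open ℚ.≤-Reasoning
    t≤δ : + suc m / suc x ℚ.+ + suc x / suc (x + suc (m + m)) ℚ.≤ δ
    t≤δ = begin
      + suc m / suc x ℚ.+ + suc x / suc (x + suc (m + m)) ≤⟨ ℚ.+-monoʳ-≤ (+ suc m / suc x) x/D≤k/x+r ⟩
      + suc m / suc x ℚ.+ (+ k / suc x ℚ.+ r)             ≡⟨ ℚ.+-assoc (+ suc m / suc x) _ r ⟨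
      (+ suc m / suc x ℚ.+ + k / suc x) ℚ.+ r             ≡⟨ cong (ℚ._+ r) (/-distribʳ-+ (suc m) k x) ⟨
      + suc (m + k) / suc x ℚ.+ r                         ≤⟨ 1+m+k/x+r≤δ ⟩
      δ                                                   ∎

module ReciprocalSums where

  open import Data.Nat using (_+_)
  open Fractions

  lookupOr : ∀ {a} {A : Set a} {n} → A → Vec A n → ℕ → A
  lookupOr z []       _       = z
  lookupOr z (x ∷ xs) zero    = x
  lookupOr z (x ∷ xs) (suc j) = lookupOr z xs j

  lookupOr-toℕ : ∀ {a} {A : Set a} {n} z (xs : Vec A n) (i : Fin n) → lookupOr z xs (toℕ i) ≡ lookup xs i
  lookupOr-toℕ z (x ∷ xs) Fin.zero    = refl
  lookupOr-toℕ z (x ∷ xs) (Fin.suc i) = lookupOr-toℕ z xs i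

  lookupOr-fromℕ< : ∀ {a} {A : Set a} {n j} z (xs : Vec A n) (j<n : j < n) → lookupOr z xs j ≡ lookup xs (fromℕ< j<n)
  lookupOr-fromℕ< z xs j<n = trans (cong (lookupOr z xs) (sym (Fin.toℕ-fromℕ< j<n))) (lookupOr-toℕ z xs (fromℕ< j<n))

  recipSum : (ℕ → ℕ) → ℕ → ℚ
  recipSum G zero    = 0ℚ
  recipSum G (suc k) = recip (G 0) ℚ.+ recipSum (G ∘ suc) k

  Dens≡recipSum : ∀ {n} (d : Vec ℕ n) → Dens d ≡ recipSum (lookupOr 0 d) n
  Dens≡recipSum []      = refl
  Dens≡recipSum (x ∷ d) = cong (recip x ℚ.+_) (Dens≡recipSum d)

  0≤recip : ∀ g → 0ℚ ℚ.≤ recip g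
  0≤recip zero    = ℚ.≤-refl
  0≤recip (suc g) = 0≤/suc 1 g

  1/[1+u]≤recip : ∀ {g u} → 1 ≤ g → g ≤ suc u → + 1 / suc u ℚ.≤ recip g
  1/[1+u]≤recip {suc g} {u} _ g<1+u = *≤*⇒/≤/ 1 u 1 g (ℕ.+-monoˡ-≤ 0 g<1+u)

  0≤recipSum : ∀ G k → 0ℚ ℚ.≤ recipSum G k
  0≤recipSum G zero    = ℚ.≤-refl
  0≤recipSum G (suc k) = ℚ.+-mono-≤ (0≤recip (G 0)) (0≤recipSum (G ∘ suc) k)

  recipSum-+ : ∀ G k c → recipSum G (k + c) ≡ recipSum G k ℚ.+ recipSum (λ j → G (k + j)) c
  recipSum-+ G zero    c = sym (ℚ.+-identityˡ _)
  recipSum-+ G (suc k) c = trans (cong (recip (G 0) ℚ.+_) (recipSum-+ (G ∘ suc) k c))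
                                 (sym (ℚ.+-assoc (recip (G 0)) _ _))

  recipSum-mono : ∀ G {k k′} → k ≤ k′ → recipSum G k ℚ.≤ recipSum G k′
  recipSum-mono G {k} k≤k′ with c , refl ← ℕ.m≤n⇒∃[o]m+o≡n k≤k′ = begin
    recipSum G k                                  ≡⟨ ℚ.+-identityʳ _ ⟨
    recipSum G k ℚ.+ 0ℚ                           ≤⟨ ℚ.+-monoʳ-≤ (recipSum G k) (0≤recipSum (λ j → G (k + j)) c) ⟩
    recipSum G k ℚ.+ recipSum (λ j → G (k + j)) c ≡⟨ recipSum-+ G k c ⟨
    recipSum G (k + c)                            ∎
    where open ℚ.≤-Reasoning

  c/[1+u]≤recipSum : ∀ G c u → (∀ j → j < c → 1 ≤ G j × G j ≤ suc u) → + c / suc u ℚ.≤ recipSum G c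
  c/[1+u]≤recipSum G zero    u _      = ℚ.≤-reflexive (0/suc≡0 u)
  c/[1+u]≤recipSum G (suc c) u bounds with 1≤G0 , G0≤1+u ← bounds 0 (s≤s z≤n) = begin
    + suc c / suc u                     ≡⟨ /-distribʳ-+ 1 c u ⟩
    + 1 / suc u ℚ.+ + c / suc u          ≤⟨ ℚ.+-mono-≤ (1/[1+u]≤recip 1≤G0 G0≤1+u)
                                            (c/[1+u]≤recipSum (G ∘ suc) c u (λ j j<c → bounds (suc j) (s≤s j<c))) ⟩
    recip (G 0) ℚ.+ recipSum (G ∘ suc) c ∎
    where open ℚ.≤-Reasoning

module Discretization where

  open import Data.Nat using (_+_)
  open ReciprocalSums using (lookupOr)

  record IsSuffixMin {n} (d : Vec ℕ n) (a : Vec ℤ n) : Set where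
    field
      ≤-shifted : ∀ {j l} → j ≤ l → l < n → lookupOr (+ 0) a j ℤ.+ + l ℤ.≤ + lookupOr 0 d l ℤ.+ + j
      attained  : ∀ {j} → j < n → ∃[ p ] (j ≤ p × p < n × lookupOr (+ 0) a j ℤ.+ + p ≡ + lookupOr 0 d p ℤ.+ + j)

  private
    +-suc : ∀ x l → x ℤ.+ + suc l ≡ (x ℤ.+ + l) ℤ.+ + 1
    +-suc x l = lemma x (+ l)
      where
      lemma : ∀ x y → x ℤ.+ (+ 1 ℤ.+ y) ≡ (x ℤ.+ y) ℤ.+ + 1
      lemma = ℤ-Solver.solve-∀

    pred+suc : ∀ h l → (h ℤ.- + 1) ℤ.+ + suc l ≡ h ℤ.+ + l
    pred+suc h l = lemma h (+ l)
      where
      lemma : ∀ h y → (h ℤ.- + 1) ℤ.+ (+ 1 ℤ.+ y) ≡ h ℤ.+ y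
      lemma = ℤ-Solver.solve-∀

  discStep-isSuffixMin : ∀ {n} d₀ {ds : Vec ℕ n} {a} → IsSuffixMin ds a → IsSuffixMin (d₀ ∷ ds) (discStep d₀ a)
  discStep-isSuffixMin d₀ {[]} {[]} _ = record { ≤-shifted = ≤-shifted ; attained = attained }
    where
    ≤-shifted : ∀ {j l} → j ≤ l → l < 1 → _
    ≤-shifted {zero} {zero} _ _       = ℤ.≤-refl
    ≤-shifted {l = suc _}   _ (s≤s ())
    attained : ∀ {j} → j < 1 → _
    attained {zero}  _        = 0 , z≤n , s≤s z≤n , refl
    attained {suc _} (s≤s ())
  discStep-isSuffixMin d₀ {d₁ ∷ ds} {h ∷ t} ih = record { ≤-shifted = ≤-shifted ; attained = attained }
    where
    open IsSuffixMin ih renaming (≤-shifted to ih-≤; attained to ih-attained)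
    A = lookupOr (+ 0) (h ∷ t)
    D = lookupOr 0 (d₁ ∷ ds)
    ≤-shifted : ∀ {j l} → j ≤ l → l < suc (suc _) → _
    ≤-shifted {zero}  {zero}  _         _         = ℤ.+-monoˡ-≤ (+ 0) (ℤ.i⊓j≤j (h ℤ.- + 1) (+ d₀))
    ≤-shifted {zero}  {suc l} _         (s≤s l<n) =
      ℤ.≤-trans (ℤ.+-monoˡ-≤ (+ suc l) (ℤ.i⊓j≤i (h ℤ.- + 1) (+ d₀)))
                (ℤ.≤-trans (ℤ.≤-reflexive (pred+suc h l)) (ih-≤ z≤n l<n))
    ≤-shifted {suc j} {suc l} (s≤s j≤l) (s≤s l<n) =
      subst₂ ℤ._≤_ (sym (+-suc (A j) l)) (sym (+-suc (+ D l) j)) (ℤ.+-monoˡ-≤ (+ 1) (ih-≤ j≤l l<n))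
    attained : ∀ {j} → j < suc (suc _) → _
    attained {zero} _ with (h ℤ.- + 1) ℤ.≤? + d₀
    ... | yes h-1≤d₀ with p , _ , p<n , eq ← ih-attained (s≤s z≤n) =
      suc p , z≤n , s≤s p<n , trans (cong (ℤ._+ + suc p) (ℤ.i≤j⇒i⊓j≡i h-1≤d₀)) (trans (pred+suc h p) eq)
    ... | no h-1≰d₀ = 0 , z≤n , s≤s z≤n , cong (ℤ._+ + 0) (ℤ.i≥j⇒i⊓j≡j (ℤ.<⇒≤ (ℤ.≰⇒> h-1≰d₀)))
    attained {suc j} (s≤s j<n) with p , j≤p , p<n , eq ← ih-attained j<n =
      suc p , s≤s j≤p , s≤s p<n , trans (+-suc (A j) p) (trans (cong (ℤ._+ + 1) eq) (sym (+-suc (+ D p) j)))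

  discretized-isSuffixMin : ∀ {n} (d : Vec ℕ n) → IsSuffixMin d (discretized d)
  discretized-isSuffixMin []       = record { ≤-shifted = λ _ () ; attained = λ () }
  discretized-isSuffixMin (d₀ ∷ d) = discStep-isSuffixMin d₀ (discretized-isSuffixMin d)

module Counting where

  open import Data.Nat using (_+_)
  open ReciprocalSums using (lookupOr)

  module _ {n} (as : Vec ℤ n) where

    countT-∉ : ∀ {t b} → + suc t ℤ.≤ b → memℤ (+ suc t) as ≡ false → countT (suc t) as b ≡ suc (countT t as b)
    countT-∉ {t} {b} 1+t≤b ∉ with + suc t ℤ.≤? b
    ... | no 1+t≰b = contradiction 1+t≤b 1+t≰b
    ... | yes _ rewrite ∉ = refl

    countT-∈ : ∀ {t b} → memℤ (+ suc t) as ≡ true → countT (suc t) as b ≡ countT t as b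
    countT-∈ {t} {b} ∈ with + suc t ℤ.≤? b
    ... | no _ = refl
    ... | yes _ rewrite ∈ = refl

    countT-≤-suc : ∀ t b → countT t as b ≤ countT (suc t) as b
    countT-≤-suc t b with does (+ suc t ℤ.≤? b) ∧ not (memℤ (+ suc t) as)
    ... | true  = ℕ.n≤1+n _
    ... | false = ℕ.≤-refl

    countT-mono : ∀ {t t′} b → t ≤ t′ → countT t as b ≤ countT t′ as b
    countT-mono {t} b t≤t′ with c , refl ← ℕ.m≤n⇒∃[o]m+o≡n t≤t′ = go c
      where
      go : ∀ c → countT t as b ≤ countT (t + c) as b
      go zero    = ℕ.≤-reflexive (cong (λ s → countT s as b) (sym (ℕ.+-identityʳ t)))
      go (suc c) = ℕ.≤-trans (go c) (subst (λ s → countT (t + c) as b ≤ countT s as b) (sym (ℕ.+-suc t c))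
                                           (countT-≤-suc (t + c) b))

  #≤ : ∀ {n} → ℤ → Vec ℤ n → ℕ
  #≤ B = count (ℤ._≤? B)

  #≤-mono : ∀ {n} (as : Vec ℤ n) {B B′} → B ℤ.≤ B′ → #≤ B as ≤ #≤ B′ as
  #≤-mono []       B≤B′ = z≤n
  #≤-mono (a ∷ as) {B} {B′} B≤B′ with a ℤ.≤? B | a ℤ.≤? B′
  ... | yes _   | yes _    = s≤s (#≤-mono as B≤B′)
  ... | yes a≤B | no a≰B′  = contradiction (ℤ.≤-trans a≤B B≤B′) a≰B′
  ... | no _    | yes _    = ℕ.m≤n⇒m≤1+n (#≤-mono as B≤B′)
  ... | no _    | no _     = #≤-mono as B≤B′

  #≤-∈ : ∀ {n} (as : Vec ℤ n) {x B B′} → memℤ x as ≡ true → B ℤ.< x → x ℤ.≤ B′ →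
         suc (#≤ B as) ≤ #≤ B′ as
  #≤-∈ (a ∷ as) {x} {B} {B′} ∈ B<x x≤B′ with x ℤ.≟ a
  #≤-∈ (a ∷ as) {x} {B} {B′} ∈ B<x x≤B′ | yes refl with x ℤ.≤? B | x ℤ.≤? B′
  ... | yes x≤B | _        = contradiction B<x (ℤ.≤⇒≯ x≤B)
  ... | no _    | yes _    = s≤s (#≤-mono as (ℤ.<⇒≤ (ℤ.<-≤-trans B<x x≤B′)))
  ... | no _    | no x≰B′  = contradiction x≤B′ x≰B′
  #≤-∈ (a ∷ as) {x} {B} {B′} ∈ B<x x≤B′ | no _ with a ℤ.≤? B | a ℤ.≤? B′
  ... | yes _   | yes _    = s≤s (#≤-∈ as ∈ B<x x≤B′)
  ... | yes a≤B | no a≰B′  = contradiction (ℤ.≤-trans a≤B (ℤ.<⇒≤ (ℤ.<-≤-trans B<x x≤B′))) a≰B′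
  ... | no _    | yes _    = ℕ.m≤n⇒m≤1+n (#≤-∈ as ∈ B<x x≤B′)
  ... | no _    | no _     = #≤-∈ as ∈ B<x x≤B′

  #≤-∷ : ∀ {n} a (as : Vec ℤ n) B → #≤ B (a ∷ as) ≤ suc (#≤ B as)
  #≤-∷ a as B with a ℤ.≤? B
  ... | yes _ = ℕ.≤-refl
  ... | no _  = ℕ.n≤1+n _

  #≤-≤ : ∀ {n} (as : Vec ℤ n) B K → (∀ j → K ≤ j → j < n → B ℤ.< lookupOr (+ 0) as j) → #≤ B as ≤ K
  #≤-≤ []       B K       _     = z≤n
  #≤-≤ (a ∷ as) B zero    above with a ℤ.≤? B
  ... | yes a≤B = contradiction (above 0 z≤n (s≤s z≤n)) (ℤ.≤⇒≯ a≤B)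
  ... | no _    = #≤-≤ as B zero (λ j _ j<n → above (suc j) z≤n (s≤s j<n))
  #≤-≤ (a ∷ as) B (suc K) above =
    ℕ.≤-trans (#≤-∷ a as B) (s≤s (#≤-≤ as B K (λ j K≤j j<n → above (suc j) (s≤s K≤j) (s≤s j<n))))

  t≤countT+#≤ : ∀ {n} (as : Vec ℤ n) t {b} → + t ℤ.≤ b → t ≤ countT t as b + #≤ (+ t) as
  t≤countT+#≤ as zero    _      = z≤n
  t≤countT+#≤ as (suc t) {b} 1+t≤b = step (memℤ (+ suc t) as) refl
    where
    open ℕ.≤-Reasoning
    t≤1+t = ℤ.+≤+ (ℕ.n≤1+n t)
    ih = t≤countT+#≤ as t (ℤ.≤-trans t≤1+t 1+t≤b)
    step : ∀ m → memℤ (+ suc t) as ≡ m → suc t ≤ countT (suc t) as b + #≤ (+ suc t) as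
    step false ∉ = begin
      suc t                                 ≤⟨ s≤s ih ⟩
      suc (countT t as b + #≤ (+ t) as)     ≤⟨ s≤s (ℕ.+-monoʳ-≤ _ (#≤-mono as t≤1+t)) ⟩
      suc (countT t as b) + #≤ (+ suc t) as ≡⟨ cong (_+ #≤ (+ suc t) as) (countT-∉ as 1+t≤b ∉) ⟨
      countT (suc t) as b + #≤ (+ suc t) as ∎
    step true ∈ = begin
      suc t                                 ≤⟨ s≤s ih ⟩
      suc (countT t as b + #≤ (+ t) as)     ≡⟨ ℕ.+-suc _ _ ⟨
      countT t as b + suc (#≤ (+ t) as)     ≤⟨ ℕ.+-monoʳ-≤ _ (#≤-∈ as ∈ (ℤ.+<+ ℕ.≤-refl) ℤ.≤-refl) ⟩
      countT t as b + #≤ (+ suc t) as       ≡⟨ cong (_+ #≤ (+ suc t) as) (countT-∈ as ∈) ⟨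
      countT (suc t) as b + #≤ (+ suc t) as ∎

  countT-≥ : ∀ {n} (as : Vec ℤ n) i K → i < n →
             (∀ j → K ≤ j → j < n → + (suc i + K) ℤ.< lookupOr (+ 0) as j) →
             suc i ≤ countT (2 * n) as (+ (suc i + K))
  countT-≥ {n} as i K i<n above with 2 * n ≤? suc i + K
  ... | yes 2n≤B = ℕ.≤-trans i<n (ℕ.+-cancelʳ-≤ n n _ (begin
    n + n                                  ≡⟨ cong (_+_ n) (ℕ.+-identityʳ n) ⟨
    2 * n                                  ≤⟨ t≤countT+#≤ as (2 * n) (ℤ.+≤+ 2n≤B) ⟩
    countT (2 * n) as B + #≤ (+ (2 * n)) as ≤⟨ ℕ.+-monoʳ-≤ _ (count≤n _ as) ⟩
    countT (2 * n) as B + n                ∎))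
    where
    open ℕ.≤-Reasoning
    B = + (suc i + K)
  ... | no 2n≰B = ℕ.≤-trans (ℕ.+-cancelʳ-≤ K (suc i) _ (begin
    suc i + K                              ≤⟨ t≤countT+#≤ as (suc i + K) ℤ.≤-refl ⟩
    countT (suc i + K) as B + #≤ B as      ≤⟨ ℕ.+-monoʳ-≤ _ (#≤-≤ as B K above) ⟩
    countT (suc i + K) as B + K            ∎))
    (countT-mono as B (ℕ.<⇒≤ (ℕ.≰⇒> 2n≰B)))
    where
    open ℕ.≤-Reasoning
    B = + (suc i + K)

open Fractions
open DensityThreshold
open ReciprocalSums
open Discretization
open Counting

module Deadlines {n} (d : Vec ℕ n)
  (1≤d : ∀ {j} → j < n → 1 ≤ lookupOr 0 d j)
  (d-mono : ∀ {j l} → j ≤ l → l < n → lookupOr 0 d j ≤ lookupOr 0 d l)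
  (sparse : Dens d ≤√2-½) where

  open import Data.Nat using (_+_)
  open import Algebra.Properties.Group (AbelianGroup.group ℤ.+-0-abelianGroup) using ()
    renaming (∙-cancelʳ to ℤ-+-cancelʳ)

  D : ℕ → ℕ
  D = lookupOr 0 d

  A : ℕ → ℤ
  A = lookupOr (+ 0) (discretized d)

  open IsSuffixMin (discretized-isSuffixMin d)

  ≤recipSum⇒≤Dens : ∀ {t k} → k ≤ n → t ℚ.≤ recipSum D k → t ℚ.≤ Dens d
  ≤recipSum⇒≤Dens {k = k} k≤n t≤ =
    ℚ.≤-trans t≤ (subst (recipSum D k ℚ.≤_) (sym (Dens≡recipSum d)) (recipSum-mono D k≤n))

  bounded-up-to : ∀ {l y} → l < n → D l ≤ suc y → ∀ {j} → j ≤ l → 1 ≤ D j × D j ≤ suc y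
  bounded-up-to l<n Dl≤1+y j≤l = 1≤d (ℕ.≤-<-trans j≤l l<n) , ℕ.≤-trans (d-mono j≤l l<n) Dl≤1+y

  prefix-bound : ∀ {i x} → i < n → D i ≤ suc x → + suc i / suc x ℚ.≤ recipSum D (suc i)
  prefix-bound {i} {x} i<n Di≤1+x =
    c/[1+u]≤recipSum D (suc i) x (λ j j<1+i → bounded-up-to i<n Di≤1+x (ℕ.≤-pred j<1+i))

  block-bound : ∀ {t} p q {y} → p + q < n → D (p + q) ≤ suc y → t ℚ.≤ recipSum D (suc p) →
                t ℚ.+ + q / suc y ℚ.≤ recipSum D (suc (p + q))
  block-bound {t} p q {y} p+q<n Dp+q≤1+y t≤ = begin
    t ℚ.+ + q / suc y                                       ≤⟨ ℚ.+-mono-≤ t≤ (c/[1+u]≤recipSum _ q y block) ⟩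
    recipSum D (suc p) ℚ.+ recipSum (λ j → D (suc p + j)) q ≡⟨ recipSum-+ D (suc p) q ⟨
    recipSum D (suc (p + q))                                ∎
    where
    open ℚ.≤-Reasoning
    block : ∀ j → j < q → 1 ≤ D (suc p + j) × D (suc p + j) ≤ suc y
    block j j<q = bounded-up-to p+q<n Dp+q≤1+y (subst (_≤ p + q) (ℕ.+-suc p j) (ℕ.+-monoʳ-≤ p j<q))

  j<D : ∀ {j} → j < n → j < D j
  j<D {zero}  0<n   = 1≤d 0<n
  j<D {suc j} 1+j<n = ℕ.≰⇒> λ Dj≤1+j →
    1≰√2-½ (≤√2-½-antitone (0≤/suc 1 0)
      (ℚ.≤-trans 1≤[2+j]/[1+j] (≤recipSum⇒≤Dens 1+j<n (prefix-bound 1+j<n Dj≤1+j))) sparse)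
    where
    1≤[2+j]/[1+j] : 1ℚ ℚ.≤ + suc (suc j) / suc j
    1≤[2+j]/[1+j] = *≤*⇒/≤/ 1 0 (suc (suc j)) j
      (subst₂ _≤_ (sym (ℕ.*-identityˡ _)) (sym (ℕ.*-identityʳ _)) (ℕ.n≤1+n _))

  A-value : ∀ {j} → j < n → ∃[ p ] ∃[ m ] (j ≤ p × p < n × D p ≡ suc (p + m) × A j ≡ + suc (j + m))
  A-value {j} j<n with p , j≤p , p<n , eq ← attained j<n
                  with m , 1+p+m≡Dp ← ℕ.m≤n⇒∃[o]m+o≡n (j<D p<n) =
    p , m , j≤p , p<n , sym 1+p+m≡Dp , ℤ-+-cancelʳ (+ p) (A j) (+ suc (j + m)) (begin
      A j ℤ.+ + p           ≡⟨ eq ⟩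
      + (D p + j)           ≡⟨ cong (λ t → + (t + j)) 1+p+m≡Dp ⟨
      + (suc p + m + j)     ≡⟨ cong +_ (regroup p m j) ⟩
      + suc (j + m) ℤ.+ + p ∎)
    where
    open ≡-Reasoning
    regroup : ∀ p m j → suc p + m + j ≡ suc (j + m) + p
    regroup = solve-∀

  A≡⇒D≥ : ∀ {j m l} → A j ≡ + suc (j + m) → j ≤ l → l < n → suc (l + m) ≤ D l
  A≡⇒D≥ {j} {m} {l} Aj≡ j≤l l<n = ℕ.+-cancelʳ-≤ j (suc (l + m)) (D l)
    (subst (_≤ D l + j) (regroup j m l)
      (ℤ.drop‿+≤+ (subst (λ a → a ℤ.+ + l ℤ.≤ + D l ℤ.+ + j) Aj≡ (≤-shifted j≤l l<n))))
    where
    regroup : ∀ j m l → suc (j + m) + l ≡ suc (l + m) + j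
    regroup = solve-∀

  twoBlocks-impossible : ∀ {x m k q} → m + k + q < n → D (m + k) ≡ suc x → D (m + k + q) ≡ suc (m + k + q + m) →
                         m + k ≤ x → suc x + m ≤ m + k + q → ⊥
  twoBlocks-impossible {x} {m} {k} {q} p<n Di≡1+x Dp≡1+p+m i≤x K≤p =
    [1+m+k]/x+r≰√2-½ x m k (+ q / suc (m + k + q + m))
      (x/[x+2m+1]≤twoBlocks x m k q k≤1+x 1+x≤k+q)
      (≤recipSum⇒≤Dens p<n
        (block-bound (m + k) q p<n (ℕ.≤-reflexive Dp≡1+p+m) (prefix-bound i<n (ℕ.≤-reflexive Di≡1+x))))
      sparse
    where
    i<n = ℕ.≤-<-trans (ℕ.m≤m+n (m + k) q) p<n
    k≤1+x = ℕ.≤-trans (ℕ.m≤n+m k m) (ℕ.≤-trans i≤x (ℕ.n≤1+n x))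
    regroup : ∀ m k q → m + k + q ≡ k + q + m
    regroup = solve-∀
    1+x≤k+q = ℕ.+-cancelʳ-≤ m (suc x) (k + q) (ℕ.≤-trans K≤p (ℕ.≤-reflexive (regroup m k q)))

  threeBlocks-impossible : ∀ {x m k q e} → m + k + q + e < n →
                           D (m + k) ≡ suc x → D (m + k + q) ≡ suc (m + k + q + m) →
                           D (m + k + q + e) ≤ suc (m + k + q + e + (m + k)) →
                           m + k + q < suc x + m → suc x + m ≤ m + k + q + e → ⊥
  threeBlocks-impossible {x} {m} {k} {q} {e} l<n Di≡1+x Dp≡1+p+m Dl≤1+l+i p<K K≤l
    with c , p+c≡K ← ℕ.m≤n⇒∃[o]m+o≡n (ℕ.<⇒≤ p<K)
    with g , refl ← ℕ.m≤n⇒∃[o]m+o≡n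
                      (ℕ.+-cancelˡ-≤ (m + k + q) c e (subst (_≤ m + k + q + e) (sym p+c≡K) K≤l)) =
    [1+m+k]/x+r≰√2-½ x m k _
      (x/[x+2m+1]≤threeBlocks x m k q c g p+c≡K c≤1+2m)
      (subst (ℚ._≤ Dens d) (ℚ.+-assoc (+ suc (m + k) / suc x) _ _)
        (≤recipSum⇒≤Dens l<n (block-bound (m + k + q) (c + g) l<n Dl≤1+l+i
          (block-bound (m + k) q p<n (ℕ.≤-reflexive Dp≡1+p+m) (prefix-bound i<n (ℕ.≤-reflexive Di≡1+x))))))
      sparse
    where
    p<n = ℕ.≤-<-trans (ℕ.m≤m+n (m + k + q) (c + g)) l<n
    i<n = ℕ.≤-<-trans (ℕ.m≤m+n (m + k) q) p<n
    x≤p+m : x ≤ m + k + q + m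
    x≤p+m = ℕ.≤-pred (subst₂ _≤_ Di≡1+x Dp≡1+p+m (d-mono (ℕ.m≤m+n (m + k) q) p<n))
    regroup : ∀ p m → suc (p + m) + m ≡ p + suc (m + m)
    regroup = solve-∀
    c≤1+2m : c ≤ suc (m + m)
    c≤1+2m = ℕ.+-cancelˡ-≤ (m + k + q) c (suc (m + m)) (begin
      m + k + q + c            ≡⟨ p+c≡K ⟩
      suc x + m                ≤⟨ ℕ.+-monoˡ-≤ m (s≤s x≤p+m) ⟩
      suc (m + k + q + m) + m  ≡⟨ regroup (m + k + q) m ⟩
      m + k + q + suc (m + m)  ∎)
      where open ℕ.≤-Reasoning

  module _ {i p m x} (i≤p : i ≤ p) (p<n : p < n) (Dp≡1+p+m : D p ≡ suc (p + m))
           (Ai≡1+i+m : A i ≡ + suc (i + m)) (Di≡1+x : D i ≡ suc x) where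

    K : ℕ
    K = suc x + m

    i+m≤x : i + m ≤ x
    i+m≤x = ℕ.≤-pred (subst (suc (i + m) ≤_) Di≡1+x (A≡⇒D≥ Ai≡1+i+m ℕ.≤-refl (ℕ.≤-<-trans i≤p p<n)))

    i≤K : i ≤ K
    i≤K = ℕ.≤-trans (ℕ.m≤m+n i m) (ℕ.≤-trans i+m≤x (ℕ.≤-trans (ℕ.n≤1+n x) (ℕ.m≤m+n (suc x) m)))

    short-tail⇒m≤i : ∀ {l} → i ≤ l → l < n → D l ≤ suc (l + i) → m ≤ i
    short-tail⇒m≤i {l} i≤l l<n Dl≤1+l+i =
      ℕ.+-cancelˡ-≤ l m i (ℕ.≤-pred (ℕ.≤-trans (A≡⇒D≥ Ai≡1+i+m i≤l l<n) Dl≤1+l+i))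

    short-tail-impossible : ∀ {l} → K ≤ l → l < n → D l ≤ suc (l + i) → ⊥
    short-tail-impossible {l} K≤l l<n Dl≤1+l+i
      with k , refl ← ℕ.m≤n⇒∃[o]m+o≡n (short-tail⇒m≤i (ℕ.≤-trans i≤K K≤l) l<n Dl≤1+l+i)
      with q , refl ← ℕ.m≤n⇒∃[o]m+o≡n i≤p
      with K ≤? m + k + q
    ... | yes K≤p = twoBlocks-impossible p<n Di≡1+x Dp≡1+p+m (ℕ.≤-trans (ℕ.m≤m+n (m + k) m) i+m≤x) K≤p
    ... | no K≰p with e , refl ← ℕ.m≤n⇒∃[o]m+o≡n (ℕ.<⇒≤ (ℕ.<-≤-trans (ℕ.≰⇒> K≰p) K≤l)) =
      threeBlocks-impossible l<n Di≡1+x Dp≡1+p+m Dl≤1+l+i (ℕ.≰⇒> K≰p) K≤l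

    D-tail : ∀ {l} → K ≤ l → l < n → suc (l + suc i) ≤ D l
    D-tail {l} K≤l l<n = ℕ.≰⇒> (short-tail-impossible K≤l l<n ∘ subst (D l ≤_) (ℕ.+-suc l i))

    A-tail : ∀ j → K ≤ j → j < n → + (suc i + K) ℤ.< A j
    A-tail j K≤j j<n with pⱼ , mⱼ , j≤pⱼ , pⱼ<n , Dpⱼ≡1+pⱼ+mⱼ , Aj≡1+j+mⱼ ← A-value j<n =
      subst (+ (suc i + K) ℤ.<_) (sym Aj≡1+j+mⱼ) (ℤ.+<+ (s≤s (begin
        suc i + K ≤⟨ ℕ.+-mono-≤ 1+i≤mⱼ K≤j ⟩
        mⱼ + j    ≡⟨ ℕ.+-comm mⱼ j ⟩
        j + mⱼ    ∎)))
      where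
      open ℕ.≤-Reasoning
      1+i≤mⱼ : suc i ≤ mⱼ
      1+i≤mⱼ = ℕ.+-cancelˡ-≤ pⱼ (suc i) mⱼ
        (ℕ.≤-pred (subst (suc (pⱼ + suc i) ≤_) Dpⱼ≡1+pⱼ+mⱼ (D-tail (ℕ.≤-trans K≤j j≤pⱼ) pⱼ<n)))

  i<|T∩[dᵢ+aᵢ]| : ∀ {i} → i < n → suc i ≤ countT (2 * n) (discretized d) (+ D i ℤ.+ A i)
  i<|T∩[dᵢ+aᵢ]| {i} i<n with p , m , i≤p , p<n , Dp≡1+p+m , Ai≡1+i+m ← A-value i<n
                        with x , 1+x≡Di ← ℕ.m≤n⇒∃[o]m+o≡n (1≤d i<n) =
    subst (λ B → suc i ≤ countT (2 * n) (discretized d) B) (sym D+A≡)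
      (countT-≥ (discretized d) i (suc x + m) i<n (A-tail i≤p p<n Dp≡1+p+m Ai≡1+i+m (sym 1+x≡Di)))
    where
    regroup : ∀ x i m → suc x + suc (i + m) ≡ suc i + (suc x + m)
    regroup = solve-∀
    D+A≡ : + D i ℤ.+ A i ≡ + (suc i + (suc x + m))
    D+A≡ = trans (cong₂ (λ u v → + u ℤ.+ v) (sym 1+x≡Di) Ai≡1+i+m) (cong +_ (regroup x i m))

-- Natural-number _+_ is opened only inside the modules above, so that here _+_ is the
-- integer addition of the statement.
open import Data.Integer using (_+_)

lemma9 : (n : ℕ) (d : Vec ℕ n) →
    (∀ i → 1 ≤ lookup d i) →
    (∀ i j → toℕ i ≤ toℕ j → lookup d i ≤ lookup d j) →
    (∀ i → lookup d i ≤ 2 * n) →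
    ((Dens d ℚ.+ ℚ.½) ℚ.* (Dens d ℚ.+ ℚ.½) ℚ.≤ ℚ.1ℚ ℚ.+ ℚ.1ℚ) →
    ∀ (i : Fin n) →
      suc (toℕ i) ≤ countT (2 * n) (discretized d) (+ lookup d i + lookup (discretized d) i)
lemma9 n d 1≤d d-mono _ sparse i =
  subst₂ (λ u v → suc (toℕ i) ≤ countT (2 * n) (discretized d) (+ u + v))
    (lookupOr-toℕ 0 d i) (lookupOr-toℕ (+ 0) (discretized d) i)
    (Deadlines.i<|T∩[dᵢ+aᵢ]| d 1≤d′ d-mono′ sparse (Fin.toℕ<n i))
  where
  1≤d′ : ∀ {j} → j < n → 1 ≤ lookupOr 0 d j
  1≤d′ j<n = subst (1 ≤_) (sym (lookupOr-fromℕ< 0 d j<n)) (1≤d (fromℕ< j<n))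
  d-mono′ : ∀ {j l} → j ≤ l → l < n → lookupOr 0 d j ≤ lookupOr 0 d l
  d-mono′ j≤l l<n = subst₂ _≤_ (sym (lookupOr-fromℕ< 0 d j<n)) (sym (lookupOr-fromℕ< 0 d l<n))
    (d-mono (fromℕ< j<n) (fromℕ< l<n) (subst₂ _≤_ (sym (Fin.toℕ-fromℕ< j<n)) (sym (Fin.toℕ-fromℕ< l<n)) j≤l))
    where j<n = ℕ.≤-<-trans j≤l l<n
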